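{- Let $k\ge 2$ be an integer and let ${\bf w}$ be an infinite word that avoids $k$-th powers, i.e. contains no factor of the form $u^k$ with $u$ a nonempty word. If $i_1\le i_2<i_3$ and ${\bf w}[i_1..i_2]$ and ${\bf w}[i_1..i_3]$ are both palindromes, then $$\frac{|{\bf w}[i_1..i_3]|}{|{\bf w}[i_1..i_2]|}>1+\frac{1}{k-1}.$$
   Context: ${\bf w}[i..j]$ denotes the factor ${\bf w}[i]{\bf w}[i+1]\cdots{\bf w}[j]$ and $|x|$ the length of a word. A palindrome is a finite word equal to its reversal. -}

module Defs where

open import Data.Nat using (ℕ; zero; suc; _+_; _∸_)
open import Data.List using (List; []; _∷_; _++_; reverse; length)
open import Data.Product using (∃-syntax; _×_)
open import Relation.Binary.PropositionalEquality using (_≡_)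
open import Relation.Nullary using (¬_)

InfWord : Set → Set
InfWord A = ℕ → A

factorFrom : {A : Set} → InfWord A → ℕ → ℕ → List A
factorFrom w i zero    = []
factorFrom w i (suc n) = w i ∷ factorFrom w (suc i) n

-- w[i..j] = w[i] w[i+1] ... w[j]  (used with i ≤ j; length j - i + 1)
_[_‥_] : {A : Set} → InfWord A → ℕ → ℕ → List A
w [ i ‥ j ] = factorFrom w i (suc (j ∸ i))

IsFactor : {A : Set} → List A → InfWord A → Set
IsFactor u w = ∃[ i ] factorFrom w i (length u) ≡ u

_^ʷ_ : {A : Set} → List A → ℕ → List A
u ^ʷ zero  = []
u ^ʷ suc k = u ++ (u ^ʷ k)

AvoidsPowers : {A : Set} → ℕ → InfWord A → Set
AvoidsPowers {A} k w = (u : List A) → ¬ (u ≡ []) → ¬ IsFactor (u ^ʷ k) w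

Palindrome : {A : Set} → List A → Set
Palindrome x = reverse x ≡ x

-- Two palindromic prefixes P ⊏ Q of lengths p < q force Q to have period d = q − p: reflecting
-- position d + j in Q and then position j in P lands at the same letter. A word of period d
-- begins with the power of its first d letters of exponent ⌊q/d⌋, so avoiding k-th powers
-- gives k d > q, which is k p < (k − 1) q.
module Submission where

open import Defs
open import Data.Nat using (ℕ; zero; suc; _+_; _*_; _∸_; _≤_; _<_; z≤n; s≤s)
open import Data.Nat.Properties
open import Data.List using (List; []; _∷_; _++_; reverse; length; applyUpTo; applyDownFrom)
open import Data.List.Properties using (∷-injectiveˡ; ∷-injectiveʳ; reverse-applyUpTo; length-applyUpTo)
open import Data.Product using (_,_)
open import Relation.Binary.PropositionalEquality
open import Relation.Nullary using (¬_)

module _ {A : Set} where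

  applyUpTo-cong : ∀ {f g : ℕ → A} n → (∀ j → j < n → f j ≡ g j) → applyUpTo f n ≡ applyUpTo g n
  applyUpTo-cong zero    f≗g = refl
  applyUpTo-cong (suc n) f≗g =
    cong₂ _∷_ (f≗g 0 (s≤s z≤n)) (applyUpTo-cong n (λ j j<n → f≗g (suc j) (s≤s j<n)))

  applyUpTo-injective : ∀ {f g : ℕ → A} n → applyUpTo f n ≡ applyUpTo g n → ∀ j → j < n → f j ≡ g j
  applyUpTo-injective (suc n) eq zero    _         = ∷-injectiveˡ eq
  applyUpTo-injective (suc n) eq (suc j) (s≤s j<n) = applyUpTo-injective n (∷-injectiveʳ eq) j j<n

  applyUpTo-+ : ∀ (f : ℕ → A) m n → applyUpTo f (m + n) ≡ applyUpTo f m ++ applyUpTo (λ j → f (m + j)) n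
  applyUpTo-+ f zero    n = refl
  applyUpTo-+ f (suc m) n = cong (f 0 ∷_) (applyUpTo-+ (λ j → f (suc j)) m n)

  applyDownFrom-applyUpTo : ∀ (f : ℕ → A) n → applyDownFrom f n ≡ applyUpTo (λ j → f (n ∸ suc j)) n
  applyDownFrom-applyUpTo f zero    = refl
  applyDownFrom-applyUpTo f (suc n) = cong (f n ∷_) (applyDownFrom-applyUpTo f n)

  palindrome-reflect : ∀ (f : ℕ → A) n → Palindrome (applyUpTo f n) → ∀ j → j < n → f j ≡ f (n ∸ suc j)
  palindrome-reflect f n pal = applyUpTo-injective n (begin
    applyUpTo f n                         ≡⟨ pal ⟨
    reverse (applyUpTo f n)               ≡⟨ reverse-applyUpTo f n ⟩
    applyDownFrom f n                     ≡⟨ applyDownFrom-applyUpTo f n ⟩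
    applyUpTo (λ j → f (n ∸ suc j)) n     ∎)
    where open ≡-Reasoning

  HasPeriod : ℕ → ℕ → (ℕ → A) → Set
  HasPeriod d n f = ∀ j → d + j < n → f (d + j) ≡ f j

  palindromes⇒hasPeriod : ∀ (f : ℕ → A) d p → Palindrome (applyUpTo f p) → Palindrome (applyUpTo f (d + p)) →
                          HasPeriod d (d + p) f
  palindromes⇒hasPeriod f d p palP palQ j d+j<d+p = begin
    f (d + j)                  ≡⟨ palindrome-reflect f (d + p) palQ (d + j) d+j<d+p ⟩
    f (d + p ∸ suc (d + j))    ≡⟨ cong (λ i → f (d + p ∸ i)) (sym (+-suc d j)) ⟩
    f (d + p ∸ (d + suc j))    ≡⟨ cong f ([m+n]∸[m+o]≡n∸o d p (suc j)) ⟩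
    f (p ∸ suc j)              ≡⟨ palindrome-reflect f p palP j (+-cancelˡ-< d j p d+j<d+p) ⟨
    f j                        ∎
    where open ≡-Reasoning

  hasPeriod⇒power : ∀ (f : ℕ → A) d n → HasPeriod d n f →
                    ∀ m → m * d ≤ n → applyUpTo f (m * d) ≡ applyUpTo f d ^ʷ m
  hasPeriod⇒power f d n per zero    _       = refl
  hasPeriod⇒power f d n per (suc m) [1+m]d≤n = begin
    applyUpTo f (d + m * d)                                  ≡⟨ applyUpTo-+ f d (m * d) ⟩
    applyUpTo f d ++ applyUpTo (λ j → f (d + j)) (m * d)     ≡⟨ cong (applyUpTo f d ++_) (applyUpTo-cong (m * d) shift) ⟩
    applyUpTo f d ++ applyUpTo f (m * d)                     ≡⟨ cong (applyUpTo f d ++_) (hasPeriod⇒power f d n per m md≤n) ⟩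
    applyUpTo f d ++ applyUpTo f d ^ʷ m                      ∎
    where
    open ≡-Reasoning
    md≤n : m * d ≤ n
    md≤n = ≤-trans (m≤n+m (m * d) d) [1+m]d≤n
    shift : ∀ j → j < m * d → f (d + j) ≡ f j
    shift j j<md = per j (<-≤-trans (+-monoʳ-< d j<md) [1+m]d≤n)

module _ {A : Set} (w : InfWord A) where

  factorFrom-applyUpTo : ∀ i n → factorFrom w i n ≡ applyUpTo (λ j → w (i + j)) n
  factorFrom-applyUpTo i zero    = refl
  factorFrom-applyUpTo i (suc n) = cong₂ _∷_ (cong w (sym (+-identityʳ i)))
    (trans (factorFrom-applyUpTo (suc i) n) (applyUpTo-cong n (λ j _ → cong w (sym (+-suc i j)))))

  length-factorFrom : ∀ i n → length (factorFrom w i n) ≡ n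
  length-factorFrom i n = trans (cong length (factorFrom-applyUpTo i n)) (length-applyUpTo _ n)

  palindromic-prefixes⇒power : ∀ i d p → Palindrome (factorFrom w i p) → Palindrome (factorFrom w i (d + p)) →
                               ∀ m → m * d ≤ d + p → IsFactor (factorFrom w i d ^ʷ m) w
  palindromic-prefixes⇒power i d p palP palQ m md≤q = i , (begin
    factorFrom w i (length (u ^ʷ m))                  ≡⟨ cong (λ v → factorFrom w i (length v)) power ⟨
    factorFrom w i (length (applyUpTo f (m * d)))     ≡⟨ cong (factorFrom w i) (length-applyUpTo f (m * d)) ⟩
    factorFrom w i (m * d)                            ≡⟨ factorFrom-applyUpTo i (m * d) ⟩
    applyUpTo f (m * d)                               ≡⟨ power ⟩
    u ^ʷ m                                            ∎)
    where
    open ≡-Reasoning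
    f : ℕ → A
    f j = w (i + j)
    u : List A
    u = factorFrom w i d
    asApplyUpTo : ∀ {n} → Palindrome (factorFrom w i n) → Palindrome (applyUpTo f n)
    asApplyUpTo {n} = subst Palindrome (factorFrom-applyUpTo i n)
    power : applyUpTo f (m * d) ≡ u ^ʷ m
    power = trans (hasPeriod⇒power f d (d + p) (palindromes⇒hasPeriod f d p (asApplyUpTo palP) (asApplyUpTo palQ)) m md≤q)
                  (cong (_^ʷ m) (sym (factorFrom-applyUpTo i d)))

  avoidsPowers⇒palindromic-prefixes-gap : ∀ k → AvoidsPowers k w → ∀ i d p → 0 < d →
    Palindrome (factorFrom w i p) → Palindrome (factorFrom w i (d + p)) → d + p < k * d
  avoidsPowers⇒palindromic-prefixes-gap k avoids i d p 0<d palP palQ = ≰⇒> λ kd≤q →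
    avoids (factorFrom w i d) u≢[] (palindromic-prefixes⇒power i d p palP palQ k kd≤q)
    where
    u≢[] : ¬ factorFrom w i d ≡ []
    u≢[] u≡[] = <⇒≢ 0<d (trans (cong length (sym u≡[])) (length-factorFrom i d))

cross-multiplied-bound : ∀ k d p → d + p < k * d → k * p < (k ∸ 1) * (d + p)
cross-multiplied-bound (suc k) d p q<[1+k]d = begin-strict
  p + k * p        <⟨ +-monoˡ-< (k * p) (+-cancelˡ-< d p (k * d) q<[1+k]d) ⟩
  k * d + k * p    ≡⟨ *-distribˡ-+ k d p ⟨
  k * (d + p)      ∎
  where open ≤-Reasoning

mainTheorem6 : {A : Set} (k : ℕ) → 2 ≤ k → (w : InfWord A) → AvoidsPowers k w →
    (i₁ i₂ i₃ : ℕ) → i₁ ≤ i₂ → i₂ < i₃ →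
    Palindrome (w [ i₁ ‥ i₂ ]) → Palindrome (w [ i₁ ‥ i₃ ]) →
    k * length (w [ i₁ ‥ i₂ ]) < (k ∸ 1) * length (w [ i₁ ‥ i₃ ])
mainTheorem6 k _ w avoids i₁ i₂ i₃ i₁≤i₂ i₂<i₃ palP palQ =
  subst₂ (λ m n → k * m < (k ∸ 1) * n)
    (sym (length-factorFrom w i₁ p)) (sym (trans (length-factorFrom w i₁ _) q≡d+p))
    (cross-multiplied-bound k d p
      (avoidsPowers⇒palindromic-prefixes-gap w k avoids i₁ d p (m<n⇒0<n∸m i₂<i₃) palP
        (subst (λ n → Palindrome (factorFrom w i₁ n)) q≡d+p palQ)))
  where
  p d : ℕ
  p = suc (i₂ ∸ i₁)
  d = i₃ ∸ i₂
  q≡d+p : suc (i₃ ∸ i₁) ≡ d + p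
  q≡d+p = begin
    suc (i₃ ∸ i₁)              ≡⟨ cong (λ n → suc (n ∸ i₁)) (m∸n+n≡m (<⇒≤ i₂<i₃)) ⟨
    suc (d + i₂ ∸ i₁)          ≡⟨ cong suc (+-∸-assoc d i₁≤i₂) ⟩
    suc (d + (i₂ ∸ i₁))        ≡⟨ +-suc d (i₂ ∸ i₁) ⟨
    d + p                      ∎
    where open ≡-Reasoning
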